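{- Assume that $\lambda$ is Scott-continuous, which implies the existence of a finitary winning strategy $S^{\exists}_{p,\lambda}$ for $\exists$ in the primal way-below game on $\lambda\colon\mathbb{L}\to\mathbb{L}$. Let $\dot b\in M_{\mathbb{B}}$ and let $a$ be a dual witness for $\dot b$ (so $\alpha(a)\not\sqsubseteq\dot b$). Let $A=S^{\exists}_{p,\lambda}(a)$. Given a move $\dot d\in\mathbb{B}$ of $\exists$ in the dual game on $\beta$, the player $\forall$ plays $\dot b'=Z(\alpha(\bigsqcup A),\dot d)$, which has a dual witness $a'=A_d(\dot b',A)$ with $\deg(a')<\deg(a)$. Continuing from $\dot b'$ and $a'$ yields a winning strategy for $\forall$ in the dual game on $\beta\colon\mathbb{B}\to\mathbb{B}$.
   Context: Let $\mathbb{L}$ and $\mathbb{B}$ be complete lattices with a Galois connection $\alpha\dashv\gamma$ ($\alpha\colon\mathbb{L}\to\mathbb{B}$, $\gamma\colon\mathbb{B}\to\mathbb{L}$ monotone, $\ell\sqsubseteq\gamma\alpha(\ell)$, $\alpha\gamma(d)\sqsubseteq d$), and monotone maps $\lambda\colon\mathbb{L}\to\mathbb{L}$, $\beta\colon\mathbb{B}\to\mathbb{B}$ with $\alpha\circ\lambda=\beta\circ\alpha$ (so $\alpha(\mu\lambda)=\mu\beta$). $\ll$ is the way-below relation; $\mathbb{L}$ is continuous with join basis $J_{\mathbb{L}}$ (each $\ell=\bigsqcup\{j\in J_{\mathbb{L}}\mid j\sqsubseteq\ell\}$), $\bot\notin J_{\mathbb{L}}$. Write $\bigwedge$ for meets.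 $\mathbb{B}$ is co-continuous with meet basis $M_{\mathbb{B}}$ (each $x=\bigwedge\{m\in M_{\mathbb{B}}\mid m\sqsupseteq x\}$), $\top\notin M_{\mathbb{B}}$, where the way-above relation $x\triangleleft y$ means: for every filtered $F$ with $\bigwedge F\sqsubseteq x$ there is $f\in F$ with $f\sqsubseteq y$, and co-continuity means $x=\bigwedge\{y\mid x\triangleleft y\}$. Degree: $\deg(a)=\min\{i\in\mathsf{Ord}\mid a\ll\lambda^i(\bot)\}$. A dual witness for $b\in\mathbb{B}$ is $a\in\mathbb{L}$ with $a\ll\mu\lambda$ and $\alpha(a)\not\sqsubseteq b$. Primal way-below game on $\lambda$: at $a\in J_{\mathbb{L}}$, $\exists$ picks $\ell\in\mathbb{L}$ with $a\ll\lambda(\ell)$; at $\ell$, $\forall$ picks $a'\in J_{\mathbb{L}}$ with $a'\ll\ell$; a player unable to move loses, infinite plays are won by $\forall$. The finitary strategy assigns to $a\ll\mu\lambda$ a finite set $S^{\exists}_{p,\lambda}(a)\subseteq J_{\mathbb{L}}$, $\exists$ plays its join, $a\ll\lambda(\bigsqcup S^{\exists}_{p,\lambda}(a))$ and every element has degree $<\deg(a)$. Dual game on $\beta$: at $\dot b\in M_{\mathbb{B}}$, $\exists$ picks $\dot d$ with $\beta(\dot d)\sqsubseteq\dot b$; at $\dot d$, $\forall$ picks $\dot b'\in M_{\mathbb{B}}$ with $\dot d\triangleleft\dot b'$; a player unable to move loses, infinite plays are won by $\exists$. Auxiliary functions: $Z(\dot e,\dot d)$, defined when $\dot e\not\sqsubseteq\dot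 d$, returns some $\dot b'\in M_{\mathbb{B}}$ with $\dot d\triangleleft\dot b'$ and $\dot e\not\sqsubseteq\dot b'$; $A_d(\dot b,A)$, for $\dot b\in M_{\mathbb{B}}$ and finite $A\subseteq J_{\mathbb{L}}$ with $\alpha(\bigsqcup A)\not\sqsubseteq\dot b$, returns some $a\in J_{\mathbb{L}}$ with $a\ll\bigsqcup A$ and $\alpha(a)\not\sqsubseteq\dot b$. -}

module Defs where

open import Level using (Level; _⊔_) renaming (suc to lsuc)
open import Data.Nat using (ℕ; zero; suc; _<_)
open import Data.Product using (Σ; ∃; _×_; _,_)
open import Data.List using (List)
open import Data.List.Membership.Propositional using (_∈_)
open import Data.List.Relation.Unary.All using (All)
open import Data.Empty.Polymorphic using (⊥)
open import Relation.Nullary using (¬_)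
open import Relation.Binary.PropositionalEquality using (_≡_)

record CompleteLattice (ℓ : Level) : Set (lsuc ℓ) where
  infix 4 _⊑_
  field
    Carrier  : Set ℓ
    _⊑_      : Carrier → Carrier → Set ℓ
    ⊑-refl   : ∀ {x} → x ⊑ x
    ⊑-trans  : ∀ {x y z} → x ⊑ y → y ⊑ z → x ⊑ z
    ⊑-antisym : ∀ {x y} → x ⊑ y → y ⊑ x → x ≡ y
    ⨆        : (Carrier → Set ℓ) → Carrier
    ⨆-upper  : ∀ (P : Carrier → Set ℓ) x → P x → x ⊑ ⨆ P
    ⨆-least  : ∀ (P : Carrier → Set ℓ) u → (∀ x → P x → x ⊑ u) → ⨆ P ⊑ u
    ⨅        : (Carrier → Set ℓ) → Carrier
    ⨅-lower  : ∀ (P : Carrier → Set ℓ) x → P x → ⨅ P ⊑ x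
    ⨅-greatest : ∀ (P : Carrier → Set ℓ) u → (∀ x → P x → u ⊑ x) → u ⊑ ⨅ P

  ⊥ₗ : Carrier
  ⊥ₗ = ⨆ (λ _ → ⊥)

  ⊤ₗ : Carrier
  ⊤ₗ = ⨅ (λ _ → ⊥)

  ⨆ₗ : List Carrier → Carrier
  ⨆ₗ A = ⨆ (λ x → x ∈ A)

  Directed : (Carrier → Set ℓ) → Set ℓ
  Directed D = (∃ λ x → D x)
             × (∀ x y → D x → D y → ∃ λ z → D z × x ⊑ z × y ⊑ z)

  Filtered : (Carrier → Set ℓ) → Set ℓ
  Filtered F = (∃ λ x → F x)
             × (∀ x y → F x → F y → ∃ λ z → F z × z ⊑ x × z ⊑ y)

  _≪_ : Carrier → Carrier → Set (lsuc ℓ)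
  a ≪ b = ∀ (D : Carrier → Set ℓ) → Directed D → b ⊑ ⨆ D → ∃ λ d → D d × a ⊑ d

  _◁_ : Carrier → Carrier → Set (lsuc ℓ)
  x ◁ y = ∀ (F : Carrier → Set ℓ) → Filtered F → ⨅ F ⊑ x → ∃ λ f → F f × f ⊑ y

  Monotone : (Carrier → Carrier) → Set ℓ
  Monotone f = ∀ {x y} → x ⊑ y → f x ⊑ f y

  ScottContinuous : (Carrier → Carrier) → Set (lsuc ℓ)
  ScottContinuous f = ∀ (D : Carrier → Set ℓ) → Directed D →
    f (⨆ D) ≡ ⨆ (λ y → ∃ λ x → D x × y ≡ f x)

  -- least fixed point (Knaster–Tarski)
  μ : (Carrier → Carrier) → Carrier
  μ f = ⨅ (λ x → f x ⊑ x)

  iter : (Carrier → Carrier) → ℕ → Carrier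
  iter f zero    = ⊥ₗ
  iter f (suc n) = f (iter f n)

  HasDeg : (Carrier → Carrier) → Carrier → ℕ → Set (lsuc ℓ)
  HasDeg f a n = a ≪ iter f n × (∀ m → m < n → ¬ (a ≪ iter f m))

  DegLt : (Carrier → Carrier) → Carrier → Carrier → Set (lsuc ℓ)
  DegLt f x a = Σ ℕ λ n → Σ ℕ λ m → HasDeg f x n × HasDeg f a m × n < m

module Setting {ℓ : Level} (𝕃 𝔹 : CompleteLattice ℓ) where
  open CompleteLattice 𝕃 public using () renaming
    ( Carrier to L ; _⊑_ to _⊑L_ ; ⨆ to ⨆L ; ⨆ₗ to ⨆A ; _≪_ to _≪_
    ; ⊥ₗ to ⊥L ; Monotone to MonotoneL ; ScottContinuous to ScottContinuousL
    ; μ to μL ; iter to iterL ; DegLt to DegLt )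
  open CompleteLattice 𝔹 public using () renaming
    ( Carrier to B ; _⊑_ to _⊑B_ ; ⨅ to ⨅B ; _◁_ to _◁_ ; ⊤ₗ to ⊤B
    ; Monotone to MonotoneB ; μ to μB )

  record Assumptions : Set (lsuc ℓ) where
    field
      α          : L → B
      γ          : B → L
      α-mono     : ∀ {x y} → x ⊑L y → α x ⊑B α y
      γ-mono     : ∀ {x y} → x ⊑B y → γ x ⊑L γ y
      unit       : ∀ l → l ⊑L γ (α l)
      counit     : ∀ d → α (γ d) ⊑B d
      -- Λ stands for the paper's λ (a reserved word in Agda)
      Λ          : L → L
      β          : B → B
      Λ-mono     : MonotoneL Λ
      β-mono     : MonotoneB β
      commute    : ∀ l → α (Λ l) ≡ β (α l)
      -- 𝕃 continuous with join basis J, ⊥ ∉ J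
      -- (l = ⨆{y | y ≪ l}, written as "l is below every upper bound of
      --  {y | y ≪ l}" since that set lives one universe up; the other
      --  inequality holds automatically)
      L-continuous : ∀ l u → (∀ y → y ≪ l → y ⊑L u) → l ⊑L u
      J          : L → Set ℓ
      J-basis    : ∀ l → l ≡ ⨆L (λ j → J j × j ⊑L l)
      ⊥∉J        : ¬ J ⊥L
      -- 𝔹 co-continuous with meet basis M, ⊤ ∉ M
      -- (x = ⨅{y | x ◁ y}, written analogously)
      B-cocontinuous : ∀ x u → (∀ y → x ◁ y → u ⊑B y) → u ⊑B x
      M          : B → Set ℓ
      M-basis    : ∀ x → x ≡ ⨅B (λ m → M m × x ⊑B m)
      ⊤∉M        : ¬ M ⊤B
      Λ-scott    : ScottContinuousL Λ
      -- finitary winning strategy S for ∃ in the primal way-below game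
      S          : L → List L
      S-spec     : ∀ a → a ≪ μL Λ →
                     All J (S a) × a ≪ Λ (⨆A (S a))
                     × All (λ x → DegLt Λ x a) (S a)
      Z          : B → B → B
      Z-spec     : ∀ e d → ¬ (e ⊑B d) → M (Z e d) × d ◁ Z e d × ¬ (e ⊑B Z e d)
      Ad         : B → List L → L
      Ad-spec    : ∀ b A → M b → All J A → ¬ (α (⨆A A) ⊑B b) →
                     J (Ad b A) × Ad b A ≪ ⨆A A × ¬ (α (Ad b A) ⊑B b)

  module _ (H : Assumptions) where
    open Assumptions H

    DualWitness : B → L → Set (lsuc ℓ)
    DualWitness b a = a ≪ μL Λ × ¬ (α a ⊑B b)

    next-b : L → B → B
    next-b a d = Z (α (⨆A (S a))) d

    next-a : L → B → L
    next-a a d = Ad (next-b a d) (S a)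

    -- Being inductive,
    -- every play along the strategy is finite, i.e. ends with ∃ unable to
    -- move: the strategy is winning for ∀.
    data ForallWins (b : B) (a : L) : Set (lsuc ℓ) where
      wins : (∀ d → β d ⊑B b →
                 M (next-b a d) × d ◁ next-b a d
                 × DualWitness (next-b a d) (next-a a d)
                 × DegLt Λ (next-a a d) a
                 × ForallWins (next-b a d) (next-a a d))
             → ForallWins b a

-- The answer ḃ' = Z(α(⨆A), ḋ) to a move ḋ of ∃ is legal, since α(⨆A) ⊑ ḋ would give
-- α a ⊑ α(λ(⨆A)) = β(α(⨆A)) ⊑ β ḋ ⊑ ḃ. The new witness
-- a' ≪ ⨆A sits below a join of elements of degree < deg(a), so its degree drops.
-- Since a ≪ λᴺ(⊥) for some finite N and nothing way below ⊥ is a dual witness,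
-- every play following this strategy has at most N rounds.
module Submission where

open import Defs
open import Level using (Level)
open import Data.Nat using (zero; suc; _≤_; s≤s; s≤s⁻¹)
open import Data.Nat.Properties using (≮⇒≥; <-≤-trans)
open import Data.Product using (∃; _×_; _,_; proj₁)
open import Data.Sum using (_⊎_; inj₁; inj₂)
open import Data.List using ([]; _∷_)
open import Data.List.Relation.Unary.All as All using (All; []; _∷_)
open import Data.Empty using (⊥-elim)
open import Relation.Nullary using (¬_)
open import Relation.Binary.PropositionalEquality using (subst; sym)

module CompleteLatticeProperties {ℓ : Level} (𝕃 : CompleteLattice ℓ) where
  open CompleteLattice 𝕃

  ⊥ₗ-least : ∀ {x} → ⊥ₗ ⊑ x
  ⊥ₗ-least = ⨆-least _ _ (λ _ ())

  ⨆ₗ-least : ∀ {A u} → All (_⊑ u) A → ⨆ₗ A ⊑ u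
  ⨆ₗ-least A⊑u = ⨆-least _ _ (λ _ x∈A → All.lookup A⊑u x∈A)

  ≪⇒⊑ : ∀ {a x} → a ≪ x → a ⊑ x
  ≪⇒⊑ {x = x} a≪x with a≪x (_⊑ x) ((x , ⊑-refl) , λ _ _ y⊑x z⊑x → x , ⊑-refl , y⊑x , z⊑x)
                                (⨆-upper _ x ⊑-refl)
  ... | _ , d⊑x , a⊑d = ⊑-trans a⊑d d⊑x

  ≪-⊑-trans : ∀ {a x y} → a ≪ x → x ⊑ y → a ≪ y
  ≪-⊑-trans a≪x x⊑y D D-directed y⊑⨆D = a≪x D D-directed (⊑-trans x⊑y y⊑⨆D)

  HasDeg-minimal : ∀ {f a m k} → HasDeg f a m → a ≪ iter f k → m ≤ k
  HasDeg-minimal (_ , below-m-not-≪) a≪k = ≮⇒≥ (λ k<m → below-m-not-≪ _ k<m a≪k)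

  module _ {f : Carrier → Carrier} (f-mono : Monotone f) where

    μ-prefixed : f (μ f) ⊑ μ f
    μ-prefixed = ⨅-greatest _ _ (λ x fx⊑x → ⊑-trans (f-mono (⨅-lower _ x fx⊑x)) fx⊑x)

    iter⊑μ : ∀ n → iter f n ⊑ μ f
    iter⊑μ zero    = ⊥ₗ-least
    iter⊑μ (suc n) = ⊑-trans (f-mono (iter⊑μ n)) μ-prefixed

    iter-mono : ∀ {m n} → m ≤ n → iter f m ⊑ iter f n
    iter-mono {zero}          _   = ⊥ₗ-least
    iter-mono {suc m} {suc n} m≤n = f-mono (iter-mono (s≤s⁻¹ m≤n))

    DegLt⇒⊑iter : ∀ {x a} N → DegLt f x a → a ≪ iter f (suc N) → x ⊑ iter f N
    DegLt⇒⊑iter N (n , m , (x≪iter , _) , hasDeg-a , n<m) a≪iter =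
      ⊑-trans (≪⇒⊑ x≪iter) (iter-mono {n} {N} (s≤s⁻¹ (<-≤-trans n<m m≤1+N)))
      where
      m≤1+N : m ≤ suc N
      m≤1+N = HasDeg-minimal {k = suc N} hasDeg-a a≪iter

    ⨆ₗ-DegLt⊑iter : ∀ {A a} N → All (λ x → DegLt f x a) A → a ≪ iter f (suc N) → ⨆ₗ A ⊑ iter f N
    ⨆ₗ-DegLt⊑iter N degs a≪iter = ⨆ₗ-least (All.map (λ deg → DegLt⇒⊑iter N deg a≪iter) degs)

module _ {ℓ : Level} {𝕃 𝔹 : CompleteLattice ℓ} (H : Setting.Assumptions 𝕃 𝔹) where
  open Setting 𝕃 𝔹
  open Assumptions H
  open CompleteLattice 𝕃 using (⊑-trans; HasDeg)
  open CompleteLatticeProperties 𝕃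
  private module 𝔹 = CompleteLattice 𝔹

  ⊑γ⇒α⊑ : ∀ {l b} → l ⊑L γ b → α l ⊑B b
  ⊑γ⇒α⊑ {b = b} l⊑γb = 𝔹.⊑-trans (α-mono l⊑γb) (counit b)

  J⇒¬≪⊥ : ∀ {a} → J a → ¬ (a ≪ ⊥L)
  J⇒¬≪⊥ Ja a≪⊥ = ⊥∉J (subst J (CompleteLattice.⊑-antisym 𝕃 (≪⇒⊑ a≪⊥) ⊥ₗ-least) Ja)

  α⋢-along-β : ∀ {a l b d} → a ⊑L Λ l → ¬ (α a ⊑B b) → β d ⊑B b → ¬ (α l ⊑B d)
  α⋢-along-β {l = l} {b} a⊑Λl αa⋢b βd⊑b αl⊑d = αa⋢b
    (𝔹.⊑-trans (α-mono a⊑Λl) (subst (_⊑B b) (sym (commute l)) (𝔹.⊑-trans (β-mono αl⊑d) βd⊑b)))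

  ≪μ⇒≪Λ⊥⊎HasDeg : ∀ {a} → a ≪ μL Λ → a ≪ iterL Λ 1 ⊎ ∃ (HasDeg Λ a)
  ≪μ⇒≪Λ⊥⊎HasDeg {a} a≪μ with S a | S-spec a a≪μ
  ... | []    | _ , a≪Λ⨆[] , _                     = inj₁ (≪-⊑-trans a≪Λ⨆[] (Λ-mono (⨆ₗ-least [])))
  ... | _ ∷ _ | _ , _ , (_ , m , _ , hasDeg , _) ∷ _ = inj₂ (m , hasDeg)

  ≪μ⇒≪iter : ∀ {a} → a ≪ μL Λ → ∃ λ N → a ≪ iterL Λ N
  ≪μ⇒≪iter a≪μ with ≪μ⇒≪Λ⊥⊎HasDeg a≪μ
  ... | inj₁ a≪Λ⊥         = 1 , a≪Λ⊥
  ... | inj₂ (m , hasDeg) = m , proj₁ hasDeg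

  -- Degrees need not exist constructively; for basis elements they are read off S.
  J⇒HasDeg : ∀ {a} → J a → a ≪ μL Λ → ∃ (HasDeg Λ a)
  J⇒HasDeg Ja a≪μ with ≪μ⇒≪Λ⊥⊎HasDeg a≪μ
  ... | inj₁ a≪Λ⊥ = 1 , a≪Λ⊥ , λ { zero _ → J⇒¬≪⊥ Ja ; (suc _) (s≤s ()) }
  ... | inj₂ deg  = deg

  J-≪⨆-DegLt : ∀ {x a A} → J x → x ≪ ⨆A A → All (λ y → DegLt Λ y a) A → DegLt Λ x a
  J-≪⨆-DegLt Jx x≪⨆[] [] = ⊥-elim (J⇒¬≪⊥ Jx (≪-⊑-trans x≪⨆[] (⨆ₗ-least [])))
  J-≪⨆-DegLt {x} Jx x≪⨆A degs@((_ , suc m , _ , hasDeg-a , _) ∷ _) =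
    let n , hasDeg-x = J⇒HasDeg Jx (≪-⊑-trans x≪iter (iter⊑μ Λ-mono m))
    in n , suc m , hasDeg-x , hasDeg-a , s≤s (HasDeg-minimal {k = m} hasDeg-x x≪iter)
    where
    x≪iter : x ≪ iterL Λ m
    x≪iter = ≪-⊑-trans x≪⨆A (⨆ₗ-DegLt⊑iter Λ-mono m degs (proj₁ hasDeg-a))

  forallWins-below : ∀ N {b a} → DualWitness H b a → a ≪ iterL Λ N → ForallWins H b a
  forallWins-below zero (_ , αa⋢b) a≪⊥ =
    ⊥-elim (αa⋢b (⊑γ⇒α⊑ (⊑-trans (≪⇒⊑ a≪⊥) ⊥ₗ-least)))
  forallWins-below (suc N) {b} {a} (a≪μ , αa⋢b) a≪iter = wins response
    where
    response : ∀ d → β d ⊑B b →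
                 let b′ = next-b H a d ; a′ = next-a H a d in
                 M b′ × d ◁ b′ × DualWitness H b′ a′ × DegLt Λ a′ a × ForallWins H b′ a′
    response d βd⊑b with S-spec a a≪μ
    ... | JS , a≪Λ⨆S , degs with Z-spec _ d (α⋢-along-β (≪⇒⊑ a≪Λ⨆S) αa⋢b βd⊑b)
    ... | Mb′ , d◁b′ , α⨆S⋢b′ with Ad-spec _ _ Mb′ JS α⨆S⋢b′
    ... | Ja′ , a′≪⨆S , αa′⋢b′ =
      Mb′ , d◁b′ , witness′ , J-≪⨆-DegLt Ja′ a′≪⨆S degs , forallWins-below N witness′ a′≪iter
      where
      a′≪iter : next-a H a d ≪ iterL Λ N
      a′≪iter = ≪-⊑-trans a′≪⨆S (⨆ₗ-DegLt⊑iter Λ-mono N degs a≪iter)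
      witness′ : DualWitness H (next-b H a d) (next-a H a d)
      witness′ = ≪-⊑-trans a′≪iter (iter⊑μ Λ-mono N) , αa′⋢b′

proposition20 : ∀ {ℓ} (𝕃 𝔹 : CompleteLattice ℓ) (H : Setting.Assumptions 𝕃 𝔹) →
    let open Setting 𝕃 𝔹 in
    ∀ (b : B) (a : L) → Assumptions.M H b → DualWitness H b a → ForallWins H b a
proposition20 𝕃 𝔹 H b a _ witness@(a≪μ , _) =
  let N , a≪iter = ≪μ⇒≪iter H a≪μ in forallWins-below H N witness a≪iter
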